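{- Let $\mathcal{H}$ be a 3-uniform hypergraph containing no copy of $\mathcal{M}$, let $\mathcal{H}'$ be its 13-core, and let $Z$ be the set of vertices $z \in V(\mathcal{H}')$ with $\tau(Tr_{\mathcal{H}'}(z)) = 1$. If $z \in Z$ and $y$ is the center of the star $Tr_{\mathcal{H}'}(z)$, then $\tau(Tr_{\mathcal{H}'}(y)) \ge 4$. Furthermore, if $u$ is any leaf of the star $Tr_{\mathcal{H}'}(z)$, then $\tau(Tr_{\mathcal{H}'}(u)) = 1$.
   Context: The messy path $\mathcal{M}$ is $\{abc, bcd, def\}$ on six distinct vertices. The 13-core is obtained by iteratively deleting vertices of degree less than 13 (with their triples) until all remaining vertices have degree at least 13. $Tr_{\mathcal{H}'}(v) = \{ e \setminus \{v\} : e \in \mathcal{H}', v \in e\}$ is the trace graph of $v$; $\tau$ is the vertex cover number. A graph with vertex cover number 1 and at least 13 edges is a star with a unique center. -}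

module Defs where

open import Data.Nat using (ℕ; zero; suc; _≤_; _<_)
open import Data.Fin using (Fin; _≟_; #_)
open import Data.Bool using (Bool; true; false; _∧_; if_then_else_)
open import Data.List using (List; length)
open import Data.List.Membership.Propositional using (_∈_)
open import Data.Product using (Σ; _×_; proj₁; proj₂)
open import Data.Sum using (_⊎_)
open import Relation.Nullary using (¬_; does)
open import Relation.Binary.PropositionalEquality using (_≡_; _≢_)
open import Function.Definitions using (Injective)

record Hyp3 (n : ℕ) : Set where
  field
    E          : Fin n → Fin n → Fin n → Bool
    E-sym₁     : ∀ a b c → E a b c ≡ E b a c
    E-sym₂     : ∀ a b c → E a b c ≡ E a c b
    E-distinct : ∀ a b c → E a b c ≡ true → (a ≢ b) × (b ≢ c) × (a ≢ c)
open Hyp3 public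

Graph : ℕ → Set
Graph n = Fin n → Fin n → Bool

VSet : ℕ → Set
VSet n = Fin n → Bool

remove : ∀ {n} → Fin n → VSet n → VSet n
remove v S w = if does (w ≟ v) then false else S w

Tr : ∀ {n} → Hyp3 n → VSet n → Fin n → Graph n
Tr H S v a b = S v ∧ (S a ∧ (S b ∧ E H v a b))

SamePair : ∀ {n} → Fin n × Fin n → Fin n × Fin n → Set
SamePair p q = ((proj₁ p ≡ proj₁ q) × (proj₂ p ≡ proj₂ q))
             ⊎ ((proj₁ p ≡ proj₂ q) × (proj₂ p ≡ proj₁ q))

AtLeastEdges : ∀ {n} → ℕ → Graph n → Set
AtLeastEdges {n} k G =
  Σ (Fin k → Fin n × Fin n) λ f →
    (∀ i → G (proj₁ (f i)) (proj₂ (f i)) ≡ true) ×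
    (∀ i j → SamePair (f i) (f j) → i ≡ j)

-- deg_{H[S]}(v) ≥ k  (edges at v correspond bijectively to edges of its trace).
DegAtLeast : ∀ {n} → ℕ → Hyp3 n → VSet n → Fin n → Set
DegAtLeast k H S v = AtLeastEdges k (Tr H S v)

data Deletion {n : ℕ} (k : ℕ) (H : Hyp3 n) : VSet n → Set where
  start  : Deletion k H (λ _ → true)
  delete : ∀ {S} (v : Fin n) → Deletion k H S → S v ≡ true →
           ¬ DegAtLeast k H S v → Deletion k H (remove v S)

-- S is (the vertex set of) the k-core: a terminal state of the deletion process.
IsCore : ∀ {n} → ℕ → Hyp3 n → VSet n → Set
IsCore k H S = Deletion k H S × (∀ v → S v ≡ true → DegAtLeast k H S v)

Covers : ∀ {n} → Graph n → List (Fin n) → Set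
Covers G C = ∀ a b → G a b ≡ true → (a ∈ C) ⊎ (b ∈ C)

τ≤ : ∀ {n} → Graph n → ℕ → Set
τ≤ {n} G k = Σ (List (Fin n)) λ C → (length C ≤ k) × Covers G C

τ≥ : ∀ {n} → Graph n → ℕ → Set
τ≥ G k = ∀ m → m < k → ¬ τ≤ G m

τ≡ : ∀ {n} → Graph n → ℕ → Set
τ≡ G k = τ≤ G k × τ≥ G k

IsCenter : ∀ {n} → Graph n → Fin n → Set
IsCenter G y = ∀ a b → G a b ≡ true → (a ≡ y) ⊎ (b ≡ y)

MFree : ∀ {n} → Hyp3 n → Set
MFree {n} H = ∀ (g : Fin 6 → Fin n) → Injective _≡_ _≡_ g →
  ¬ ((E H (g (# 0)) (g (# 1)) (g (# 2)) ≡ true) × (E H (g (# 1)) (g (# 2)) (g (# 3)) ≡ true) × (E H (g (# 3)) (g (# 4)) (g (# 5)) ≡ true))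

module Submission where

-- Leaves are stars: if u is a leaf (Tr z y u) and {a,b} an edge of Tr u missing y, then
-- either a or b is z, and then {u,b} (resp. {u,a}) is an edge of Tr z missing y, which is
-- absurd; or a, b ∉ {y,z}, and a leaf ℓ of z outside {u,a,b} (z has k ≥ 4 leaves) gives
-- the messy path ℓzy, zyu, uab.  Hence Tr u is a nonempty star and τ(Tr u) = 1.
--
-- The centre has large cover number: a cover C of Tr y with |C| < k misses some leaf ℓ
-- of z; Tr ℓ is a star centred at y with k leaves, so it has a leaf w ∉ C, and the edge
-- {ℓ,w} of Tr y is uncovered.  So τ(Tr y) ≥ k ≥ 4.

open import Defs
open import Data.Nat using (ℕ; _≤_; _<_; z≤n; s≤s)
open import Data.Nat.Properties using (≤-<-trans; <-≤-trans; m≤m+n)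
open import Data.Fin using (Fin) renaming (zero to fzero; suc to fsuc)
open import Data.Fin.Properties using (pigeonhole; all?; ¬∀⟶∃¬; <⇒≢; _≟_)
open import Data.Bool using (Bool; true; _∧_)
open import Data.List using (List; []; _∷_; length; lookup)
open import Data.List.Membership.Propositional using (_∈_; _∉_)
open import Data.List.Membership.Propositional.Properties using (∈-lookup)
import Data.List.Membership.DecPropositional as DecMembership
open import Data.List.Relation.Unary.All using ([]; _∷_) renaming (lookup to lookupAll)
open import Data.List.Relation.Unary.AllPairs using (AllPairs; []; _∷_)
open import Data.List.Relation.Unary.Any using (here; there; index)
open import Data.List.Relation.Unary.Any.Properties using (lookup-index)
open import Data.Product using (Σ; ∃-syntax; _×_; _,_; proj₁; proj₂)
open import Data.Sum using (_⊎_; inj₁; inj₂; [_,_]′)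
open import Data.Empty using (⊥; ⊥-elim)
open import Function.Definitions using (Injective)
open import Relation.Binary.Definitions using (DecidableEquality)
open import Relation.Nullary using (yes; no)
open import Relation.Binary.PropositionalEquality
  using (_≡_; _≢_; refl; sym; trans; cong; ≢-sym; module ≡-Reasoning)

lookup-injective : ∀ {A : Set} {xs : List A} → AllPairs _≢_ xs → Injective _≡_ _≡_ (lookup xs)
lookup-injective (_ ∷ _) {fzero} {fzero} _ = refl
lookup-injective (x≢rest ∷ _) {fzero} {fsuc j} eq = ⊥-elim (lookupAll x≢rest (∈-lookup j) eq)
lookup-injective (x≢rest ∷ _) {fsuc i} {fzero} eq = ⊥-elim (lookupAll x≢rest (∈-lookup i) (sym eq))
lookup-injective (_ ∷ distinct) {fsuc i} {fsuc j} eq = cong fsuc (lookup-injective distinct eq)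

module _ {A : Set} (_≟A_ : DecidableEquality A) where
  open DecMembership _≟A_ using (_∈?_)

  escapes : ∀ {k} (w : Fin k → A) → Injective _≡_ _≡_ w →
    (C : List A) → length C < k → ∃[ i ] w i ∉ C
  escapes {k} w inj C short with all? (λ i → w i ∈? C)
  ... | no notAll = ¬∀⟶∃¬ k (λ i → w i ∈ C) (λ i → w i ∈? C) notAll
  ... | yes allIn with pigeonhole short (λ i → index (allIn i))
  ...   | i , j , i<j , samePos = ⊥-elim (<⇒≢ i<j (inj w-same))
    where
    open ≡-Reasoning
    w-same : w i ≡ w j
    w-same = begin
      w i                        ≡⟨ lookup-index (allIn i) ⟩
      lookup C (index (allIn i)) ≡⟨ cong (lookup C) samePos ⟩
      lookup C (index (allIn j)) ≡⟨ sym (lookup-index (allIn j)) ⟩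
      w j                        ∎

SamePair-common : ∀ {n} {a b a′ b′ c x : Fin n} →
  SamePair (a , b) (c , x) → SamePair (a′ , b′) (c , x) → SamePair (a , b) (a′ , b′)
SamePair-common (inj₁ (refl , refl)) (inj₁ (refl , refl)) = inj₁ (refl , refl)
SamePair-common (inj₁ (refl , refl)) (inj₂ (refl , refl)) = inj₂ (refl , refl)
SamePair-common (inj₂ (refl , refl)) (inj₁ (refl , refl)) = inj₂ (refl , refl)
SamePair-common (inj₂ (refl , refl)) (inj₂ (refl , refl)) = inj₁ (refl , refl)

SymmetricGraph : ∀ {n} → Graph n → Set
SymmetricGraph G = ∀ a b → G a b ≡ true → G b a ≡ true

AtLeastNeighbours : ∀ {n} → ℕ → Graph n → Fin n → Set
AtLeastNeighbours {n} k G c =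
  Σ (Fin k → Fin n) λ w → (∀ i → G c (w i) ≡ true) × Injective _≡_ _≡_ w

module _ {n} (G : Graph n) {c : Fin n} where

  star-neighbours : ∀ {k} → SymmetricGraph G → IsCenter G c → AtLeastEdges k G →
    AtLeastNeighbours k G c
  star-neighbours symm centre (f , isEdge , distinct) =
    (λ i → proj₁ (leaf i)) , (λ i → proj₁ (proj₂ (leaf i))) , leaf-injective
    where
    other-end : ∀ {a b} → G a b ≡ true → a ≡ c ⊎ b ≡ c →
      Σ (Fin n) λ x → G c x ≡ true × SamePair (a , b) (c , x)
    other-end {b = b} e (inj₁ refl) = b , e , inj₁ (refl , refl)
    other-end {a = a} e (inj₂ refl) = a , symm _ _ e , inj₂ (refl , refl)

    leaf : ∀ i → Σ (Fin n) λ x → G c x ≡ true × SamePair (f i) (c , x)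
    leaf i = other-end (isEdge i) (centre _ _ (isEdge i))

    leaf-injective : Injective _≡_ _≡_ (λ i → proj₁ (leaf i))
    leaf-injective {i} {j} same with leaf i | leaf j
    ... | x , _ , fi~cx | x′ , _ , fj~cx′ with refl ← same =
      distinct i j (SamePair-common fi~cx fj~cx′)

  fresh-neighbour : ∀ {k} → AtLeastNeighbours k G c → (C : List (Fin n)) → length C < k →
    ∃[ x ] G c x ≡ true × x ∉ C
  fresh-neighbour (w , adjacent , injective) C short
    with i , wi∉C ← escapes _≟_ w injective C short = w i , adjacent i , wi∉C

  star-τ≡1 : ∀ {a b} → IsCenter G c → G a b ≡ true → τ≡ G 1
  star-τ≡1 {a} {b} centre edge = (c ∷ [] , s≤s z≤n , centre-covers) , nonempty
    where
    centre-covers : Covers G (c ∷ [])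
    centre-covers a′ b′ e with centre a′ b′ e
    ... | inj₁ a′≡c = inj₁ (here a′≡c)
    ... | inj₂ b′≡c = inj₂ (here b′≡c)

    nonempty : τ≥ G 1
    nonempty _ (s≤s z≤n) ([] , _ , covers) with covers a b edge
    ... | inj₁ ()
    ... | inj₂ ()

τ≥-weaken : ∀ {n} {G : Graph n} {k m} → m ≤ k → τ≥ G k → τ≥ G m
τ≥-weaken m≤k large j j<m = large j (<-≤-trans j<m m≤k)

module _ {n} (H : Hyp3 n) where

  E-swap₁₂ : ∀ {a b c} → E H a b c ≡ true → E H b a c ≡ true
  E-swap₁₂ {a} {b} {c} e = trans (sym (E-sym₁ H a b c)) e

  E-swap₂₃ : ∀ {a b c} → E H a b c ≡ true → E H a c b ≡ true
  E-swap₂₃ {a} {b} {c} e = trans (sym (E-sym₂ H a b c)) e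

  no-messy-path : MFree H → ∀ {p q r s t w} → AllPairs _≢_ (p ∷ q ∷ r ∷ s ∷ t ∷ w ∷ []) →
    E H p q r ≡ true → E H q r s ≡ true → E H s t w ≡ true → ⊥
  no-messy-path mFree {p} {q} {r} {s} {t} {w} distinct pqr qrs stw =
    mFree (lookup (p ∷ q ∷ r ∷ s ∷ t ∷ w ∷ [])) (lookup-injective distinct) (pqr , qrs , stw)

∧₄-elim : ∀ {p q r s : Bool} → p ∧ (q ∧ (r ∧ s)) ≡ true →
  p ≡ true × q ≡ true × r ≡ true × s ≡ true
∧₄-elim {true} {true} {true} {true} _ = refl , refl , refl , refl

∧₄-intro : ∀ {p q r s : Bool} → p ≡ true → q ≡ true → r ≡ true → s ≡ true →
  p ∧ (q ∧ (r ∧ s)) ≡ true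
∧₄-intro refl refl refl refl = refl

module Traces {n} (H : Hyp3 n) (S : VSet n) where

  Tr-elim : ∀ {v a b} → Tr H S v a b ≡ true →
    S v ≡ true × S a ≡ true × S b ≡ true × E H v a b ≡ true
  Tr-elim {v} {a} {b} = ∧₄-elim {S v} {S a} {S b} {E H v a b}

  Tr-edge : ∀ {v a b} → Tr H S v a b ≡ true → E H v a b ≡ true
  Tr-edge t = proj₂ (proj₂ (proj₂ (Tr-elim t)))

  Tr-distinct : ∀ {v a b} → Tr H S v a b ≡ true → (v ≢ a) × (a ≢ b) × (v ≢ b)
  Tr-distinct t = E-distinct H _ _ _ (Tr-edge t)

  Tr-swap₂₃ : ∀ {v a b} → Tr H S v a b ≡ true → Tr H S v b a ≡ true
  Tr-swap₂₃ t with Sv , Sa , Sb , e ← Tr-elim t = ∧₄-intro Sv Sb Sa (E-swap₂₃ H e)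

  Tr-swap₁₂ : ∀ {v a b} → Tr H S v a b ≡ true → Tr H S a v b ≡ true
  Tr-swap₁₂ t with Sv , Sa , Sb , e ← Tr-elim t = ∧₄-intro Sa Sv Sb (E-swap₁₂ H e)

  MinDegree : ℕ → Set
  MinDegree k = ∀ v → S v ≡ true → DegAtLeast k H S v

  star-leaves : ∀ {k v c} → MinDegree k → S v ≡ true → IsCenter (Tr H S v) c →
    AtLeastNeighbours k (Tr H S v) c
  star-leaves minDegree Sv centre =
    star-neighbours (Tr H S _) (λ _ _ → Tr-swap₂₃) centre (minDegree _ Sv)

  module _ {z y : Fin n} (centre : IsCenter (Tr H S z) y) where

    -- A trace edge of a leaf u through z must also pass through the centre y,
    -- since otherwise it would yield an edge of Tr z missing y.
    through-z : ∀ {u b} → Tr H S z y u ≡ true → Tr H S u z b ≡ true → b ≡ y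
    through-z zyu uzb with centre _ _ (Tr-swap₁₂ uzb)
    ... | inj₁ u≡y = ⊥-elim (proj₁ (proj₂ (Tr-distinct zyu)) (sym u≡y))
    ... | inj₂ b≡y = b≡y

    -- A trace edge {a,b} of a leaf u avoiding both y and z, together with a leaf ℓ of z
    -- outside {u,a,b}, forms the messy path ℓzy, zyu, uab.
    avoiding-edge-absent : MFree H → ∀ {k u a b} → 4 ≤ k → AtLeastNeighbours k (Tr H S z) y →
      Tr H S z y u ≡ true → Tr H S u a b ≡ true → a ≢ y → b ≢ y → a ≢ z → b ≢ z → ⊥
    avoiding-edge-absent mFree {u = u} {a} {b} 4≤k leaves zyu uab a≢y b≢y a≢z b≢z
      with ℓ , zyℓ , ℓ∉uab ← fresh-neighbour (Tr H S z) leaves (u ∷ a ∷ b ∷ []) 4≤k =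
      no-messy-path H mFree distinct
        (E-swap₁₂ H (E-swap₂₃ H (Tr-edge zyℓ))) (Tr-edge zyu) (Tr-edge uab)
      where
      -- the fifteen distinctions come from the three edges and the choice of ℓ
      z≢y : z ≢ y
      z≢y = proj₁ (Tr-distinct zyu)
      y≢u : y ≢ u
      y≢u = proj₁ (proj₂ (Tr-distinct zyu))
      z≢u : z ≢ u
      z≢u = proj₂ (proj₂ (Tr-distinct zyu))
      y≢ℓ : y ≢ ℓ
      y≢ℓ = proj₁ (proj₂ (Tr-distinct zyℓ))
      z≢ℓ : z ≢ ℓ
      z≢ℓ = proj₂ (proj₂ (Tr-distinct zyℓ))
      u≢a : u ≢ a
      u≢a = proj₁ (Tr-distinct uab)
      a≢b : a ≢ b
      a≢b = proj₁ (proj₂ (Tr-distinct uab))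
      u≢b : u ≢ b
      u≢b = proj₂ (proj₂ (Tr-distinct uab))
      distinct : AllPairs _≢_ (ℓ ∷ z ∷ y ∷ u ∷ a ∷ b ∷ [])
      distinct =
          (≢-sym z≢ℓ ∷ ≢-sym y≢ℓ ∷ (λ ℓ≡u → ℓ∉uab (here ℓ≡u))
            ∷ (λ ℓ≡a → ℓ∉uab (there (here ℓ≡a))) ∷ (λ ℓ≡b → ℓ∉uab (there (there (here ℓ≡b)))) ∷ [])
        ∷ (z≢y ∷ z≢u ∷ ≢-sym a≢z ∷ ≢-sym b≢z ∷ [])
        ∷ (y≢u ∷ ≢-sym a≢y ∷ ≢-sym b≢y ∷ [])
        ∷ (u≢a ∷ u≢b ∷ [])
        ∷ (a≢b ∷ [])
        ∷ []
        ∷ []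

    leaf-trace-centred : MFree H → ∀ {k u} → 4 ≤ k → AtLeastNeighbours k (Tr H S z) y →
      Tr H S z y u ≡ true → IsCenter (Tr H S u) y
    leaf-trace-centred mFree 4≤k leaves zyu a b uab with a ≟ y | b ≟ y | a ≟ z | b ≟ z
    ... | yes a≡y | _       | _        | _        = inj₁ a≡y
    ... | no _    | yes b≡y | _        | _        = inj₂ b≡y
    ... | no _    | no _    | yes refl | _        = inj₂ (through-z zyu uab)
    ... | no _    | no _    | no _     | yes refl = inj₁ (through-z zyu (Tr-swap₂₃ uab))
    ... | no a≢y  | no b≢y  | no a≢z   | no b≢z   =
      ⊥-elim (avoiding-edge-absent mFree 4≤k leaves zyu uab a≢y b≢y a≢z b≢z)

    -- With minimum degree k ≥ 4, the centre y has τ(Tr y) ≥ k: a cover of Tr y by fewer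
    -- than k vertices misses a leaf ℓ of z and then a leaf w of the star Tr ℓ, leaving
    -- the edge {ℓ,w} of Tr y uncovered.
    centre-cover-large : MFree H → ∀ {k} → 4 ≤ k → MinDegree k → S z ≡ true →
      τ≥ (Tr H S y) k
    centre-cover-large mFree {k} 4≤k minDegree Sz m m<k (C , |C|≤m , covers) =
      uncovered (≤-<-trans |C|≤m m<k)
      where
      zLeaves : AtLeastNeighbours k (Tr H S z) y
      zLeaves = star-leaves minDegree Sz centre

      ℓLeaves : ∀ {ℓ} → Tr H S z y ℓ ≡ true → AtLeastNeighbours k (Tr H S ℓ) y
      ℓLeaves zyℓ = star-leaves minDegree (proj₁ (proj₂ (proj₂ (Tr-elim zyℓ))))
                      (leaf-trace-centred mFree 4≤k zLeaves zyℓ)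

      uncovered : length C < k → ⊥
      uncovered short
        with ℓ , zyℓ , ℓ∉C ← fresh-neighbour (Tr H S z) zLeaves C short
        with w , ℓyw , w∉C ← fresh-neighbour (Tr H S ℓ) (ℓLeaves zyℓ) C short
        = [ ℓ∉C , w∉C ]′ (covers ℓ w (Tr-swap₁₂ ℓyw))

4≤13 : 4 ≤ 13
4≤13 = m≤m+n 4 9

mainTheorem13 : ∀ {n : ℕ} (H : Hyp3 n) → MFree H →
    ∀ (S : VSet n) → IsCore 13 H S →
    ∀ (z y : Fin n) → S z ≡ true → τ≡ (Tr H S z) 1 → IsCenter (Tr H S z) y →
    τ≥ (Tr H S y) 4 × (∀ (u : Fin n) → Tr H S z y u ≡ true → τ≡ (Tr H S u) 1)
mainTheorem13 H mFree S (_ , minDegree) z y Sz _ centre =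
  τ≥-weaken 4≤13 (centre-cover-large centre mFree 4≤13 minDegree Sz) , leaf-stars
  where
  open Traces H S

  leaf-stars : ∀ u → Tr H S z y u ≡ true → τ≡ (Tr H S u) 1
  leaf-stars u zyu =
    star-τ≡1 (Tr H S u)
      (leaf-trace-centred centre mFree 4≤13 (star-leaves minDegree Sz centre) zyu)
      (Tr-swap₁₂ (Tr-swap₂₃ (Tr-swap₁₂ zyu)))
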